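{- For every positive even integer $n$, there exist a monotone Boolean network $f:\{0,1\}^n\to\{0,1\}^n$ and two configurations $x,y\in\{0,1\}^n$ such that $y$ is a fixed point of $f$ and \[ \mathrm{diam}(\Gamma(f))\geq d_{\Gamma(f)}(x,y)\geq 2^{\frac{n}{2}}. \]
   Context: A Boolean network is a map $f:\{0,1\}^n\to\{0,1\}^n$, $x\mapsto (f_1(x),\dots,f_n(x))$. It is monotone if $x\leq y$ implies $f(x)\leq f(y)$, where $\leq$ is the componentwise order on $\{0,1\}^n$. The asynchronous graph $\Gamma(f)$ is the directed graph with vertex set $\{0,1\}^n$ and an arc (transition) from $x$ to $y$ whenever there is $i\in[n]$ with $f_i(x)=y_i\neq x_i$ and $y_j=x_j$ for all $j\neq i$. $d_{\Gamma(f)}(x,y)$ is the minimal number of arcs in a directed path of $\Gamma(f)$ from $x$ to $y$ ($\infty$ if none exists), and $\mathrm{diam}(\Gamma(f))=\max\{d_{\Gamma(f)}(x,y): x,y\in\{0,1\}^n,\ d_{\Gamma(f)}(x,y)<\infty\}$. -}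

module Defs where

open import Data.Nat using (ℕ; zero; suc; _≤_; _<_)
open import Data.Bool using (Bool) renaming (_≤_ to _≤ᵇ_)
open import Data.Fin using (Fin)
open import Data.Vec using (Vec; lookup)
open import Data.Product using (Σ; ∃; _×_)
open import Relation.Binary.PropositionalEquality using (_≡_; _≢_)

Config : ℕ → Set
Config n = Vec Bool n

BN : ℕ → Set
BN n = Config n → Config n

_≤c_ : ∀ {n} → Config n → Config n → Set
x ≤c y = ∀ i → lookup x i ≤ᵇ lookup y i

Monotone : ∀ {n} → BN n → Set
Monotone f = ∀ x y → x ≤c y → f x ≤c f y

Arc : ∀ {n} → BN n → Config n → Config n → Set
Arc {n} f x y = Σ (Fin n) λ i →
  (lookup (f x) i ≡ lookup y i) × (lookup y i ≢ lookup x i) ×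
  (∀ j → j ≢ i → lookup y j ≡ lookup x j)

data Path {n} (f : BN n) : Config n → Config n → ℕ → Set where
  here : ∀ {x} → Path f x x zero
  step : ∀ {x y z k} → Arc f x y → Path f y z k → Path f x z (suc k)

Dist : ∀ {n} → BN n → Config n → Config n → ℕ → Set
Dist f x y d = Path f x y d × (∀ k → Path f x y k → d ≤ k)

Diam : ∀ {n} → BN n → ℕ → Set
Diam {n} f D =
  (Σ (Config n) λ x → Σ (Config n) λ y → Dist f x y D) ×
  (∀ x y d → Dist f x y d → d ≤ D)

-- Let S be the successor map of the reflected Gray code on {0,1}^m: each step flips one bit, and
-- starting from 0…0 it runs through all 2^m words, of ranks 0, 1, …, 2^m − 1, to a fixed point.
-- Encode u by the dual-rail word (u , ¬u) ∈ {0,1}^(2m), and let the c-th output of F at w be the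
-- disjunction, over all u whose encoding lies below w, of the c-th bit of the encoding of S u.
-- Then F is monotone and maps the encoding of u to that of S u, and the asynchronous graph goes
-- from the encoding of v to that of S v in two steps: the rail of the new value of the flipped bit
-- switches on, then the rail of its old value switches off.  Conversely, every configuration from
-- which an encoding is reachable is itself an encoding (potential 2·rank) or such an intermediate
-- configuration (potential 2·rank + 1), and one transition raises the potential by at most one;
-- this only uses that S flips one bit at a time, is injective off its fixed points and raises the
-- rank by one.  So the encoding of the last Gray word, a fixed point of F, is at distance at least
-- 2 (2^m − 1) ≥ 2^m = 2^(n/2) from the encoding of 0…0.

module Submission where

open import Defs
open import Data.Bool using (Bool; true; false; not; _∧_; _∨_; _xor_; if_then_else_; b≤b; f≤t)
  renaming (_≤_ to _≤ᵇ_)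
open import Data.Bool.Properties as Bool using (not-involutive; not-injective; not-¬; ¬-not)
open import Data.Fin using (Fin; zero; suc; toℕ; _↑ˡ_; _↑ʳ_; combine; splitAt)
open import Data.Fin.Properties as Fin
  using (any?; all?; pigeonhole; toℕ<n; combine-injective; 2↔Bool)
open import Data.Nat using (ℕ; zero; suc; _+_; _*_; _∸_; _^_; _≤_; _<_; _≥_; z≤n; s≤s)
open import Data.Nat.DivMod using (_/_; m*n/n≡m)
open import Data.Nat.Divisibility using (_∣_; divides)
open import Data.Nat.Properties as ℕ
  using (≤-refl; ≤-trans; ≤-antisym; ≮⇒≥; m<1+n⇒m<n∨m≡n; ≤-pred; n<1+n; m+[n∸m]≡n;
         +-monoˡ-<)
open import Data.Product using (Σ; ∃; ∃₂; _×_; _,_; proj₁; proj₂)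
open import Data.Sum using (_⊎_; inj₁; inj₂; [_,_]′)
open import Data.Vec using (Vec; []; _∷_; lookup; _++_; map; replicate; tabulate; _[_]%=_; _[_]≔_)
import Data.Vec.Properties as Vec
open import Data.Vec.Relation.Binary.Pointwise.Extensional using (ext; Pointwise-≡⇒≡)
open import Function using (_∘_; id; Inverse)
open import Relation.Nullary using (Dec; yes; no; ¬_; contradiction)
open import Relation.Nullary.Decidable as Dec using (_×-dec_; _⊎-dec_; _→-dec_; ¬?)
open import Relation.Binary.PropositionalEquality
  using (_≡_; _≢_; refl; sym; trans; cong; cong₂; subst; subst₂; module ≡-Reasoning)

-- Extremal solutions of decidable predicates on ℕ

Minimum Maximum : (ℕ → Set) → ℕ → Set
Minimum P d = P d × (∀ j → P j → d ≤ j)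
Maximum P d = P d × (∀ j → P j → j ≤ d)

module _ {P : ℕ → Set} (P? : ∀ k → Dec (P k)) where

  minimum : ∀ {k} → P k → ∃ (Minimum P)
  minimum {k} pk = [ (λ none → contradiction pk (none k ≤-refl)) , id ]′ (search (suc k))
    where
    search : ∀ k → (∀ j → j < k → ¬ P j) ⊎ ∃ (Minimum P)
    search zero = inj₁ λ _ ()
    search (suc k) with search k
    ... | inj₂ min = inj₂ min
    ... | inj₁ none with P? k
    ...   | yes pk = inj₂ (k , pk , λ j pj → ≮⇒≥ λ j<k → none j j<k pj)
    ...   | no ¬pk = inj₁ λ j j<1+k →
            [ (λ j<k → none j j<k) , (λ { refl → ¬pk }) ]′ (m<1+n⇒m<n∨m≡n j<1+k)

  minimum? : ∀ d → Dec (Minimum P d)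
  minimum? d with P? d
  ... | no ¬pd = no (¬pd ∘ proj₁)
  ... | yes pd with minimum pd
  ...   | d′ , pd′ , least′ with d′ ℕ.≟ d
  ...     | yes refl = yes (pd′ , least′)
  ...     | no d′≢d = no λ (_ , least) → d′≢d (≤-antisym (least′ d pd) (least d′ pd′))

  maximum : ∀ B → (∀ j → P j → j < B) → ∀ {k} → P k → ∃ (Maximum P)
  maximum zero bound pk = contradiction (bound _ pk) λ ()
  maximum (suc B) bound pk with P? B
  ... | yes pB = B , pB , λ j pj → ≤-pred (bound j pj)
  ... | no ¬pB = maximum B bound′ pk
    where
    bound′ : ∀ j → P j → j < B
    bound′ j pj = [ id , (λ { refl → contradiction pj ¬pB }) ]′ (m<1+n⇒m<n∨m≡n (bound j pj))

-- Flipping one coordinate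

flip : ∀ {n} → Fin n → Vec Bool n → Vec Bool n
flip i x = x [ i ]%= not

lookup-flip : ∀ {n} (i : Fin n) x → lookup (flip i x) i ≡ not (lookup x i)
lookup-flip i x = Vec.lookup∘updateAt i x

lookup-flip′ : ∀ {n} {i j : Fin n} → i ≢ j → ∀ x → lookup (flip i x) j ≡ lookup x j
lookup-flip′ {i = i} {j} i≢j x = Vec.lookup∘updateAt′ j i (i≢j ∘ sym) x

flip-involutive : ∀ {n} (i : Fin n) x → flip i (flip i x) ≡ x
flip-involutive i x = trans (Vec.updateAt-updateAt i x) (Vec.updateAt-id-local i x (not-involutive _))

flip-comm : ∀ {n} {i j : Fin n} → i ≢ j → ∀ x → flip i (flip j x) ≡ flip j (flip i x)
flip-comm i≢j x = Vec.updateAt-commutes _ _ i≢j x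

flip-++ˡ : ∀ {m k} (x : Vec Bool m) (y : Vec Bool k) i → flip (i ↑ˡ k) (x ++ y) ≡ flip i x ++ y
flip-++ˡ (a ∷ x) y zero = refl
flip-++ˡ (a ∷ x) y (suc i) = cong (a ∷_) (flip-++ˡ x y i)

flip-++ʳ : ∀ {m k} (x : Vec Bool m) (y : Vec Bool k) i → flip (m ↑ʳ i) (x ++ y) ≡ x ++ flip i y
flip-++ʳ [] y i = refl
flip-++ʳ (a ∷ x) y i = cong (a ∷_) (flip-++ʳ x y i)

map-not-flip : ∀ {n} (i : Fin n) x → map not (flip i x) ≡ flip i (map not x)
map-not-flip i x = Vec.map-updateAt x i refl

flip-≤ : ∀ {n} (w : Vec Bool n) c → lookup w c ≡ true → flip c w ≤c w
flip-≤ w c wc≡true j with j Fin.≟ c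
... | yes refl =
  subst (_≤ᵇ lookup w c) (sym (trans (lookup-flip c w) (cong not wc≡true))) (Bool.≤-minimum _)
... | no j≢c = Bool.≤-reflexive (lookup-flip′ (j≢c ∘ sym) w)

vec-ext : ∀ {n} {x y : Vec Bool n} → (∀ i → lookup x i ≡ lookup y i) → x ≡ y
vec-ext eq = Pointwise-≡⇒≡ (ext eq)

arc⇒flip : ∀ {n} {f : BN n} {x y} → Arc f x y →
           ∃ λ i → x ≡ flip i y × lookup (f x) i ≡ lookup y i
arc⇒flip {x = x} {y} (i , fx≡y , y≢x , rest) = i , x≡flip , fx≡y
  where
  y≡flip : y ≡ flip i x
  y≡flip = vec-ext pointwise
    where
    pointwise : ∀ j → lookup y j ≡ lookup (flip i x) j
    pointwise j with j Fin.≟ i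
    ... | yes refl = trans (¬-not y≢x) (sym (lookup-flip i x))
    ... | no j≢i = trans (rest j j≢i) (sym (lookup-flip′ (j≢i ∘ sym) x))
  x≡flip : x ≡ flip i y
  x≡flip = trans (sym (flip-involutive i x)) (cong (flip i) (sym y≡flip))

flip⇒arc : ∀ {n} {f : BN n} {x} i → lookup (f x) i ≡ not (lookup x i) → Arc f x (flip i x)
flip⇒arc {x = x} i fx≡ =
  i , trans fx≡ (sym (lookup-flip i x)) , (λ eq → not-¬ refl (trans (sym eq) (lookup-flip i x))) ,
  λ j j≢i → lookup-flip′ (j≢i ∘ sym) x

-- Distances and diameter in the asynchronous graph

toFin : ∀ {n} → Vec Bool n → Fin (2 ^ n)
toFin [] = zero
toFin (b ∷ x) = combine (Inverse.from 2↔Bool b) (toFin x)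

toFin-injective : ∀ {n} {x y : Vec Bool n} → toFin x ≡ toFin y → x ≡ y
toFin-injective {x = []} {[]} _ = refl
toFin-injective {x = a ∷ x} {b ∷ y} eq with combine-injective _ _ _ _ eq
... | a≡b , x≡y = cong₂ _∷_ (from-injective a≡b) (toFin-injective x≡y)
  where
  from-injective : ∀ {a b} → Inverse.from 2↔Bool a ≡ Inverse.from 2↔Bool b → a ≡ b
  from-injective {a} {b} eq = trans (sym (Inverse.strictlyInverseˡ 2↔Bool a))
    (trans (cong (Inverse.to 2↔Bool) eq) (Inverse.strictlyInverseˡ 2↔Bool b))

∃-config? : ∀ {n} {P : Vec Bool n → Set} → (∀ x → Dec (P x)) → Dec (∃ P)
∃-config? {zero} P? = Dec.map′ ([] ,_) (λ { ([] , p) → p }) (P? [])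
∃-config? {suc n} {P} P? =
  Dec.map′ from to (∃-config? (P? ∘ (true ∷_)) ⊎-dec ∃-config? (P? ∘ (false ∷_)))
  where
  from : ∃ (P ∘ (true ∷_)) ⊎ ∃ (P ∘ (false ∷_)) → ∃ P
  from (inj₁ (x , p)) = true ∷ x , p
  from (inj₂ (x , p)) = false ∷ x , p
  to : ∃ P → ∃ (P ∘ (true ∷_)) ⊎ ∃ (P ∘ (false ∷_))
  to (true ∷ x , p) = inj₁ (x , p)
  to (false ∷ x , p) = inj₂ (x , p)

_++ᵖ_ : ∀ {n} {f : BN n} {x y z i j} → Path f x y i → Path f y z j → Path f x z (i + j)
here ++ᵖ q = q
step a p ++ᵖ q = step a (p ++ᵖ q)

module Distances {n} (f : BN n) where

  arc? : ∀ x y → Dec (Arc f x y)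
  arc? x y = any? λ i → (lookup (f x) i Bool.≟ lookup y i) ×-dec ¬? (lookup y i Bool.≟ lookup x i)
                         ×-dec all? λ j → ¬? (j Fin.≟ i) →-dec (lookup y j Bool.≟ lookup x j)

  path? : ∀ k x y → Dec (Path f x y k)
  path? zero x y = Dec.map′ (λ { refl → here }) (λ { here → refl }) (Vec.≡-dec Bool._≟_ x y)
  path? (suc k) x y = Dec.map′ (λ (_ , a , p) → step a p) (λ { (step a p) → _ , a , p })
                                (∃-config? λ z → arc? x z ×-dec path? k z y)

  dist? : ∀ x y d → Dec (Dist f x y d)
  dist? x y = minimum? (λ k → path? k x y)

  dist-exists : ∀ {x y k} → Path f x y k → ∃ (Dist f x y)
  dist-exists {x} {y} = minimum (λ k → path? k x y)

  split : ∀ {x y k} → Path f x y k → (i : Fin (suc k)) →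
          ∃ λ z → Path f x z (toℕ i) × Path f z y (k ∸ toℕ i)
  split p zero = _ , here , p
  split (step a p) (suc i) with split p i
  ... | z , q , r = z , step a q , r

  shortcut : ∀ {x y k} → Path f x y k → 2 ^ n ≤ k → ∃ λ k′ → k′ < k × Path f x y k′
  shortcut {k = k} p 2ⁿ≤k with pigeonhole (s≤s 2ⁿ≤k) (toFin ∘ proj₁ ∘ split p)
  ... | i , j , i<j , same with split p i | split p j
  ...   | _ , p₁ , _ | _ , _ , p₃ =
    _ , shorter , p₁ ++ᵖ subst (λ z → Path f z _ _) (sym (toFin-injective same)) p₃
    where
    shorter : toℕ i + (k ∸ toℕ j) < k
    shorter = subst (toℕ i + (k ∸ toℕ j) <_) (m+[n∸m]≡n (≤-pred (toℕ<n j)))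
                    (+-monoˡ-< (k ∸ toℕ j) i<j)

  dist<2^n : ∀ {x y d} → Dist f x y d → d < 2 ^ n
  dist<2^n {d = d} (p , least) with ℕ.<-≤-connex d (2 ^ n)
  ... | inj₁ d<2ⁿ = d<2ⁿ
  ... | inj₂ 2ⁿ≤d with shortcut p 2ⁿ≤d
  ...   | k′ , k′<d , p′ = contradiction (least k′ p′) (ℕ.<⇒≱ k′<d)

  attained? : ∀ d → Dec (∃₂ λ x y → Dist f x y d)
  attained? d = ∃-config? λ x → ∃-config? λ y → dist? x y d

  diam-exists : ∀ {x y d} → Dist f x y d → ∃ λ D → Diam f D × d ≤ D
  diam-exists {x} {y} {d} dist
    with maximum attained? (2 ^ n) (λ _ (_ , _ , dist) → dist<2^n dist) (x , y , dist)
  ... | D , attained , largest =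
    D , (attained , λ x y d dist → largest d (x , y , dist)) , largest d (x , y , dist)

-- Dual-rail encoding

∧-mono : ∀ {a b c d} → a ≤ᵇ b → c ≤ᵇ d → a ∧ c ≤ᵇ b ∧ d
∧-mono {d = d} f≤t _ = Bool.≤-minimum d
∧-mono {true} b≤b c≤d = c≤d
∧-mono {false} b≤b _ = b≤b

∨-mono : ∀ {a b c d} → a ≤ᵇ b → c ≤ᵇ d → a ∨ c ≤ᵇ b ∨ d
∨-mono {c = c} f≤t _ = Bool.≤-maximum c
∨-mono {true} b≤b _ = b≤b
∨-mono {false} b≤b c≤d = c≤d

-- dualRail p x x′ is the disjunction of p u over all u with u ≤ x and map not u ≤ x′.
dualRail : ∀ {k} → (Vec Bool k → Bool) → Vec Bool k → Vec Bool k → Bool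
dualRail {zero} p [] [] = p []
dualRail {suc k} p (a ∷ x) (a′ ∷ x′) =
  (a ∧ dualRail (p ∘ (true ∷_)) x x′) ∨ (a′ ∧ dualRail (p ∘ (false ∷_)) x x′)

dualRail-encoding : ∀ {k} (p : Vec Bool k → Bool) u → dualRail p u (map not u) ≡ p u
dualRail-encoding p [] = refl
dualRail-encoding p (true ∷ u) = trans (Bool.∨-identityʳ _) (dualRail-encoding _ u)
dualRail-encoding p (false ∷ u) = dualRail-encoding _ u

dualRail-blocked : ∀ {k} (p : Vec Bool k → Bool) {x x′} i →
                   lookup x i ≡ false → lookup x′ i ≡ false → dualRail p x x′ ≡ false
dualRail-blocked p {_ ∷ _} {_ ∷ _} zero refl refl = refl
dualRail-blocked p {a ∷ x} {a′ ∷ x′} (suc i) xᵢ≡false x′ᵢ≡false = begin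
  (a ∧ dualRail _ x x′) ∨ (a′ ∧ dualRail _ x x′)
    ≡⟨ cong₂ (λ l r → (a ∧ l) ∨ (a′ ∧ r)) (dualRail-blocked _ i xᵢ≡false x′ᵢ≡false)
                                          (dualRail-blocked _ i xᵢ≡false x′ᵢ≡false) ⟩
  (a ∧ false) ∨ (a′ ∧ false)
    ≡⟨ cong₂ _∨_ (Bool.∧-zeroʳ a) (Bool.∧-zeroʳ a′) ⟩
  false ∎
  where open ≡-Reasoning

dualRail-edge : ∀ {k} (p : Vec Bool k → Bool) i u →
                dualRail p (u [ i ]≔ true) (map not u [ i ]≔ true) ≡ p u ∨ p (flip i u)
dualRail-edge p zero (true ∷ u)
  rewrite dualRail-encoding (p ∘ (true ∷_)) u | dualRail-encoding (p ∘ (false ∷_)) u = refl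
dualRail-edge p zero (false ∷ u)
  rewrite dualRail-encoding (p ∘ (true ∷_)) u | dualRail-encoding (p ∘ (false ∷_)) u =
  Bool.∨-comm (p (true ∷ u)) (p (false ∷ u))
dualRail-edge p (suc i) (true ∷ u) = trans (Bool.∨-identityʳ _) (dualRail-edge _ i u)
dualRail-edge p (suc i) (false ∷ u) = dualRail-edge _ i u

dualRail-mono : ∀ {k} (p : Vec Bool k → Bool) {x x′ y y′} → x ≤c y → x′ ≤c y′ →
                dualRail p x x′ ≤ᵇ dualRail p y y′
dualRail-mono p {[]} {[]} {[]} {[]} _ _ = b≤b
dualRail-mono p {_ ∷ _} {_ ∷ _} {_ ∷ _} {_ ∷ _} x≤y x′≤y′ =
  ∨-mono (∧-mono (x≤y zero) (dualRail-mono _ (x≤y ∘ suc) (x′≤y′ ∘ suc)))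
         (∧-mono (x′≤y′ zero) (dualRail-mono _ (x≤y ∘ suc) (x′≤y′ ∘ suc)))

module _ {m : ℕ} where

  -- In enc u, the coordinate rail i b is on exactly when u_i = b.
  rail : Fin m → Bool → Fin (m + m)
  rail i true = i ↑ˡ m
  rail i false = m ↑ʳ i

  enc : Vec Bool m → Vec Bool (m + m)
  enc u = u ++ map not u

  on off : Vec Bool m → Fin m → Fin (m + m)
  on u i = rail i (lookup u i)
  off u i = rail i (not (lookup u i))

  rail-injective : ∀ i j a b → rail i a ≡ rail j b → i ≡ j × a ≡ b
  rail-injective i j true true eq = Fin.↑ˡ-injective m i j eq , refl
  rail-injective i j false false eq = Fin.↑ʳ-injective m i j eq , refl
  rail-injective i j true false eq
    with () ← trans (sym (Fin.splitAt-↑ˡ m i m))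
                    (trans (cong (splitAt m) eq) (Fin.splitAt-↑ʳ m m j))
  rail-injective i j false true eq
    with () ← trans (sym (Fin.splitAt-↑ʳ m m i))
                    (trans (cong (splitAt m) eq) (Fin.splitAt-↑ˡ m j m))

  rail-view : ∀ c → ∃₂ λ i b → c ≡ rail i b
  rail-view c with splitAt m c | Fin.join-splitAt m m c
  ... | inj₁ i | eq = i , true , sym eq
  ... | inj₂ i | eq = i , false , sym eq

  rail-on-or-off : ∀ u i b → rail i b ≡ on u i ⊎ rail i b ≡ off u i
  rail-on-or-off u i b with b Bool.≟ lookup u i
  ... | yes refl = inj₁ refl
  ... | no b≢uᵢ = inj₂ (cong (rail i) (¬-not b≢uᵢ))

  on-off-view : ∀ u c → ∃ λ i → c ≡ on u i ⊎ c ≡ off u i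
  on-off-view u c with rail-view c
  ... | i , b , refl = i , rail-on-or-off u i b

  rail≢ : ∀ {i j} a b → i ≢ j → rail i a ≢ rail j b
  rail≢ {i} {j} a b i≢j = i≢j ∘ proj₁ ∘ rail-injective i j a b

  on≢off : ∀ u {i j} → on u i ≢ off u j
  on≢off u {i} {j} eq with rail-injective i j (lookup u i) (not (lookup u j)) eq
  ... | refl , uᵢ≡not-uᵢ = not-¬ refl uᵢ≡not-uᵢ

  enc-rail-true : ∀ u i {b} → lookup u i ≡ b → lookup (enc u) (rail i b) ≡ true
  enc-rail-true u i {true} uᵢ≡b = trans (Vec.lookup-++ˡ u _ i) uᵢ≡b
  enc-rail-true u i {false} uᵢ≡b =
    trans (Vec.lookup-++ʳ u _ i) (trans (Vec.lookup-map i not u) (cong not uᵢ≡b))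

  enc-rail-true⁻¹ : ∀ u i {b} → lookup (enc u) (rail i b) ≡ true → lookup u i ≡ b
  enc-rail-true⁻¹ u i {true} eq = trans (sym (Vec.lookup-++ˡ u _ i)) eq
  enc-rail-true⁻¹ u i {false} eq =
    not-injective (trans (sym (Vec.lookup-map i not u)) (trans (sym (Vec.lookup-++ʳ u _ i)) eq))

  enc-rail-false : ∀ u i {b} → lookup u i ≢ b → lookup (enc u) (rail i b) ≡ false
  enc-rail-false u i uᵢ≢b = ¬-not (uᵢ≢b ∘ enc-rail-true⁻¹ u i)

  enc-rail-false⁻¹ : ∀ u i {b} → lookup (enc u) (rail i b) ≡ false → lookup u i ≢ b
  enc-rail-false⁻¹ u i eq uᵢ≡b with () ← trans (sym eq) (enc-rail-true u i uᵢ≡b)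

  enc-on : ∀ u i → lookup (enc u) (on u i) ≡ true
  enc-on u i = enc-rail-true u i refl

  enc-off : ∀ u i → lookup (enc u) (off u i) ≡ false
  enc-off u i = enc-rail-false u i (not-¬ refl)

  flip-rails-enc : ∀ u i a → flip (rail i a) (flip (rail i (not a)) (enc u)) ≡ enc (flip i u)
  flip-rails-enc u i true = begin
    flip (i ↑ˡ m) (flip (m ↑ʳ i) (u ++ map not u)) ≡⟨ cong (flip (i ↑ˡ m)) (flip-++ʳ u _ i) ⟩
    flip (i ↑ˡ m) (u ++ flip i (map not u))        ≡⟨ flip-++ˡ u _ i ⟩
    flip i u ++ flip i (map not u)                 ≡⟨ cong (flip i u ++_) (map-not-flip i u) ⟨
    enc (flip i u)                                 ∎
    where open ≡-Reasoning
  flip-rails-enc u i false = begin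
    flip (m ↑ʳ i) (flip (i ↑ˡ m) (u ++ map not u)) ≡⟨ cong (flip (m ↑ʳ i)) (flip-++ˡ u _ i) ⟩
    flip (m ↑ʳ i) (flip i u ++ map not u)          ≡⟨ flip-++ʳ (flip i u) _ i ⟩
    flip i u ++ flip i (map not u)                 ≡⟨ cong (flip i u ++_) (map-not-flip i u) ⟨
    enc (flip i u)                                 ∎
    where open ≡-Reasoning

  -- Both rails of i are on: the configuration halfway between enc u and enc (flip i u).
  edge : Fin m → Vec Bool m → Vec Bool (m + m)
  edge i u = flip (off u i) (enc u)

  flip-on-edge : ∀ u i → flip (on u i) (edge i u) ≡ enc (flip i u)
  flip-on-edge u i = flip-rails-enc u i (lookup u i)

  edge-flip : ∀ u i → edge i (flip i u) ≡ edge i u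
  edge-flip u i = begin
    flip (off (flip i u) i) (enc (flip i u)) ≡⟨ cong₂ flip off≡on (sym (flip-on-edge u i)) ⟩
    flip (on u i) (flip (on u i) (edge i u)) ≡⟨ flip-involutive (on u i) (edge i u) ⟩
    edge i u                                 ∎
    where
    open ≡-Reasoning
    off≡on : off (flip i u) i ≡ on u i
    off≡on = cong (rail i) (trans (cong not (lookup-flip i u)) (not-involutive _))

  edge-flip′ : ∀ u {i j} → i ≢ j → edge i (flip j u) ≡ flip (on u j) (flip (off u i) (edge j u))
  edge-flip′ u {i} {j} i≢j = begin
    flip (off (flip j u) i) (enc (flip j u)) ≡⟨ cong₂ flip off≡off (sym (flip-on-edge u j)) ⟩
    flip (off u i) (flip (on u j) (edge j u))
      ≡⟨ flip-comm (rail≢ (not (lookup u i)) (lookup u j) i≢j) (edge j u) ⟩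
    flip (on u j) (flip (off u i) (edge j u)) ∎
    where
    open ≡-Reasoning
    off≡off : off (flip j u) i ≡ off u i
    off≡off = cong (λ b → rail i (not b)) (lookup-flip′ (i≢j ∘ sym) u)

  lookup-edge-on : ∀ u i j → lookup (edge j u) (on u i) ≡ true
  lookup-edge-on u i j = trans (lookup-flip′ (on≢off u ∘ sym) (enc u)) (enc-on u i)

  lookup-edge-off : ∀ u {i j} → i ≢ j → lookup (edge j u) (off u i) ≡ false
  lookup-edge-off u {i} {j} i≢j = trans
    (lookup-flip′ (rail≢ (not (lookup u j)) (not (lookup u i)) (i≢j ∘ sym)) (enc u)) (enc-off u i)

  lookup-edge-rail : ∀ u i b → lookup (edge i u) (rail i b) ≡ true
  lookup-edge-rail u i b with rail-on-or-off u i b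
  ... | inj₁ is-on = subst (λ c → lookup (edge i u) c ≡ true) (sym is-on) (lookup-edge-on u i i)
  ... | inj₂ is-off = subst (λ c → lookup (edge i u) c ≡ true) (sym is-off)
                            (trans (lookup-flip (off u i) (enc u)) (cong not (enc-off u i)))

  Blocked : Vec Bool (m + m) → Fin m → Set
  Blocked w i = ∀ b → lookup w (rail i b) ≡ false

  flip-on-blocked : ∀ {w} u i → lookup w (on u i) ≡ true → lookup w (off u i) ≡ false →
                    Blocked (flip (on u i) w) i
  flip-on-blocked {w = w} u i on-true off-false b with rail-on-or-off u i b
  ... | inj₁ is-on = subst (λ c → lookup (flip (on u i) w) c ≡ false) (sym is-on)
                           (trans (lookup-flip (on u i) w) (cong not on-true))
  ... | inj₂ is-off = subst (λ c → lookup (flip (on u i) w) c ≡ false) (sym is-off)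
                            (trans (lookup-flip′ (on≢off u) w) off-false)

-- The dual-rail network of a map that flips one bit at a time

module Network {m} (S : Vec Bool m → Vec Bool m) where

  rails : Bool → Vec Bool (m + m) → Vec Bool m
  rails b w = tabulate λ i → lookup w (rail i b)

  network : BN (m + m)
  network w = tabulate λ c → dualRail (λ u → lookup (enc (S u)) c) (rails true w) (rails false w)

  lookup-network : ∀ w c →
    lookup (network w) c ≡ dualRail (λ u → lookup (enc (S u)) c) (rails true w) (rails false w)
  lookup-network w c = Vec.lookup∘tabulate _ c

  rails-enc : ∀ u b → rails b (enc u) ≡ (if b then u else map not u)
  rails-enc u true = trans (Vec.tabulate-cong (Vec.lookup-++ˡ u _)) (Vec.tabulate∘lookup u)
  rails-enc u false = trans (Vec.tabulate-cong (Vec.lookup-++ʳ u _)) (Vec.tabulate∘lookup (map not u))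

  network-enc : ∀ u → network (enc u) ≡ enc (S u)
  network-enc u = trans (Vec.tabulate-cong λ c → trans
    (cong₂ (dualRail _) (rails-enc u true) (rails-enc u false)) (dualRail-encoding _ u))
    (Vec.tabulate∘lookup (enc (S u)))

  network-blocked : ∀ {w i} → Blocked {m} w i → ∀ c → lookup (network w) c ≡ false
  network-blocked {w} {i} blocked c = trans (lookup-network w c)
    (dualRail-blocked _ {rails true w} {rails false w} i
      (trans (Vec.lookup∘tabulate _ i) (blocked true)) (trans (Vec.lookup∘tabulate _ i) (blocked false)))

  rails-edge : ∀ u i b → rails b (edge i u) ≡ rails b (enc u) [ i ]≔ true
  rails-edge u i b =
    vec-ext λ k → trans (Vec.lookup∘tabulate (λ k → lookup (edge i u) (rail k b)) k) (pointwise k)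
    where
    pointwise : ∀ k → lookup (edge i u) (rail k b) ≡ lookup (rails b (enc u) [ i ]≔ true) k
    pointwise k with k Fin.≟ i
    ... | yes refl = trans (lookup-edge-rail u k b) (sym (Vec.lookup∘update k (rails b (enc u)) true))
    ... | no k≢i = begin
      lookup (flip (off u i) (enc u)) (rail k b)
        ≡⟨ lookup-flip′ (rail≢ (not (lookup u i)) b (k≢i ∘ sym)) (enc u) ⟩
      lookup (enc u) (rail k b)
        ≡⟨ Vec.lookup∘tabulate _ k ⟨
      lookup (rails b (enc u)) k
        ≡⟨ Vec.lookup∘update′ k≢i (rails b (enc u)) true ⟨
      lookup (rails b (enc u) [ i ]≔ true) k ∎
      where open ≡-Reasoning

  network-edge : ∀ u i c →
    lookup (network (edge i u)) c ≡ lookup (enc (S u)) c ∨ lookup (enc (S (flip i u))) c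
  network-edge u i c = begin
    lookup (network (edge i u)) c
      ≡⟨ lookup-network (edge i u) c ⟩
    dualRail _ (rails true (edge i u)) (rails false (edge i u))
      ≡⟨ cong₂ (dualRail _) (trans (rails-edge u i true) (cong (_[ i ]≔ true) (rails-enc u true)))
                            (trans (rails-edge u i false) (cong (_[ i ]≔ true) (rails-enc u false))) ⟩
    dualRail _ (u [ i ]≔ true) (map not u [ i ]≔ true)
      ≡⟨ dualRail-edge _ i u ⟩
    lookup (enc (S u)) c ∨ lookup (enc (S (flip i u))) c ∎
    where open ≡-Reasoning

  network-monotone : Monotone network
  network-monotone x y x≤y c = subst₂ _≤ᵇ_ (sym (lookup-network x c)) (sym (lookup-network y c))
    (dualRail-mono _ (rails-mono true) (rails-mono false))
    where
    rails-mono : ∀ b → rails b x ≤c rails b y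
    rails-mono b i =
      subst₂ _≤ᵇ_ (sym (Vec.lookup∘tabulate _ i)) (sym (Vec.lookup∘tabulate _ i)) (x≤y (rail i b))

  module Simulation (rank : Vec Bool m → ℕ)
                    (S-step : ∀ v → S v ≡ v ⊎ ∃ λ j → S v ≡ flip j v)
                    (S-injective : ∀ {u v} → S u ≢ u → S v ≢ v → S u ≡ S v → u ≡ v)
                    (rank-S : ∀ {v} → S v ≢ v → rank (S v) ≡ suc (rank v)) where

    moves : ∀ {v j} → S v ≡ flip j v → S v ≢ v
    moves {v} {j} Sv≡ Sv≡v =
      not-¬ refl (trans (cong (λ x → lookup x j) (trans (sym Sv≡v) Sv≡)) (lookup-flip j v))

    flips-at : ∀ u i → lookup (S u) i ≢ lookup u i → S u ≡ flip i u
    flips-at u i differs with S-step u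
    ... | inj₁ fixed = contradiction (cong (λ x → lookup x i) fixed) differs
    ... | inj₂ (j , Su≡) with i Fin.≟ j
    ...   | yes refl = Su≡
    ...   | no i≢j =
      contradiction (trans (cong (λ x → lookup x i) Su≡) (lookup-flip′ (i≢j ∘ sym) u)) differs

    double-rank-S : ∀ {v} → S v ≢ v → 2 * rank (S v) ≡ suc (suc (2 * rank v))
    double-rank-S moving = trans (cong (2 *_) (rank-S moving)) (ℕ.*-suc 2 _)

    no-return : ∀ {v j} → S v ≡ flip j v → lookup (S (S v)) j ≡ lookup (S v) j
    no-return {v} {j} Sv≡ with lookup (S (S v)) j Bool.≟ lookup (S v) j
    ... | yes same = same
    ... | no differs = contradiction rank-loop λ eq → ℕ.<-irrefl eq (ℕ.m<n⇒m<1+n (n<1+n (rank v)))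
      where
      SSv≡ : S (S v) ≡ flip j (S v)
      SSv≡ = flips-at (S v) j differs
      rank-loop : rank v ≡ suc (suc (rank v))
      rank-loop = begin
        rank v                  ≡⟨ cong rank (trans (cong (flip j) Sv≡) (flip-involutive j v)) ⟨
        rank (flip j (S v))     ≡⟨ cong rank SSv≡ ⟨
        rank (S (S v))          ≡⟨ rank-S (moves SSv≡) ⟩
        suc (rank (S v))        ≡⟨ cong suc (rank-S (moves Sv≡)) ⟩
        suc (suc (rank v))      ∎
        where open ≡-Reasoning

    data Ranked : Vec Bool (m + m) → ℕ → Set where
      encoded : ∀ v → Ranked (enc v) (2 * rank v)
      moving  : ∀ {v j} → S v ≡ flip j v → Ranked (edge j v) (suc (2 * rank v))

    sole-rail-stays-on : ∀ (w : Vec Bool (m + m)) (u : Vec Bool m) i →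
                         lookup w (on u i) ≡ true → lookup w (off u i) ≡ false →
                         lookup (network (flip (on u i) w)) (on u i) ≢ lookup w (on u i)
    sole-rail-stays-on w u i on-true off-false arrives =
      contradiction (trans (sym switched-off) (trans arrives on-true)) λ ()
      where
      switched-off : lookup (network (flip (on u i) w)) (on u i) ≡ false
      switched-off =
        network-blocked {flip (on u i) w} {i} (flip-on-blocked {w = w} u i on-true off-false) (on u i)

    enc-predecessor : ∀ v i → lookup (network (edge i v)) (off v i) ≡ false →
                   ∃ λ k → Ranked (edge i v) k × 2 * rank v ≤ suc k
    enc-predecessor v i arrives =
      suc (2 * rank u) , subst (λ w → Ranked w (suc (2 * rank u))) (edge-flip v i) (moving Su≡) ,
      ℕ.≤-reflexive (trans (cong (λ x → 2 * rank x) (sym Su≡v)) (double-rank-S (moves Su≡)))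
      where
      u : Vec Bool m
      u = flip i v
      Su-off : lookup (enc (S u)) (off v i) ≡ false
      Su-off = Bool.∨-conicalʳ _ _ (trans (sym (network-edge v i (off v i))) arrives)
      Su≡ : S u ≡ flip i u
      Su≡ = flips-at u i λ same → enc-rail-false⁻¹ (S u) i Su-off (trans same (lookup-flip i v))
      Su≡v : S u ≡ v
      Su≡v = trans Su≡ (flip-involutive i v)

    no-backward-arc : ∀ {v j} → S v ≡ flip j v →
                   lookup (network (flip (on v j) (edge j v))) (on v j) ≢ lookup (edge j v) (on v j)
    no-backward-arc {v} {j} Sv≡ arrives =
      not-¬ refl (trans (sym SSvⱼ≡vⱼ) (trans (no-return Sv≡) Svⱼ≡))
      where
      Svⱼ≡ : lookup (S v) j ≡ not (lookup v j)
      Svⱼ≡ = trans (cong (λ x → lookup x j) Sv≡) (lookup-flip j v)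
      SSv-on : lookup (enc (S (S v))) (on v j) ≡ true
      SSv-on = begin
        lookup (enc (S (S v))) (on v j)
          ≡⟨ cong (λ x → lookup x (on v j)) (network-enc (S v)) ⟨
        lookup (network (enc (S v))) (on v j)
          ≡⟨ cong (λ x → lookup (network x) (on v j)) (trans (cong enc Sv≡) (sym (flip-on-edge v j))) ⟩
        lookup (network (flip (on v j) (edge j v))) (on v j)
          ≡⟨ arrives ⟩
        lookup (edge j v) (on v j)
          ≡⟨ lookup-edge-on v j j ⟩
        true ∎
        where open ≡-Reasoning
      SSvⱼ≡vⱼ : lookup (S (S v)) j ≡ lookup v j
      SSvⱼ≡vⱼ = enc-rail-true⁻¹ (S (S v)) j SSv-on

    no-sideways-arc : ∀ {v i j} → S v ≡ flip j v → i ≢ j →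
                  lookup (network (flip (off v i) (edge j v))) (off v i) ≢ lookup (edge j v) (off v i)
    no-sideways-arc {v} {i} {j} Sv≡ i≢j arrives =
      not-¬ refl (trans (sym (cong (λ x → lookup x i) u≡v)) uᵢ≡)
      where
      w : Vec Bool (m + m)
      w = flip (off v i) (edge j v)
      u : Vec Bool m
      u = flip i (flip j v)
      uᵢ≡ : lookup u i ≡ not (lookup v i)
      uᵢ≡ = trans (lookup-flip i (flip j v)) (cong not (lookup-flip′ (i≢j ∘ sym) v))
      edge≤w : edge i (flip j v) ≤c w
      edge≤w = subst (_≤c w) (sym (edge-flip′ v i≢j)) (flip-≤ w (on v j)
        (trans (lookup-flip′ (rail≢ (not (lookup v i)) (lookup v j) i≢j) (edge j v))
               (lookup-edge-on v j j)))
      edge-off : lookup (network (edge i (flip j v))) (off v i) ≡ false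
      edge-off = Bool.≤-antisym
        (subst (lookup (network (edge i (flip j v))) (off v i) ≤ᵇ_) (trans arrives (lookup-edge-off v i≢j))
               (network-monotone (edge i (flip j v)) w edge≤w (off v i)))
        (Bool.≤-minimum _)
      Su-off : lookup (enc (S u)) (off v i) ≡ false
      Su-off = Bool.∨-conicalʳ (lookup (enc (S (flip j v))) (off v i)) _
        (trans (sym (network-edge (flip j v) i (off v i))) edge-off)
      Su≡ : S u ≡ flip i u
      Su≡ = flips-at u i λ same → enc-rail-false⁻¹ (S u) i Su-off (trans same uᵢ≡)
      u≡v : u ≡ v
      u≡v = S-injective (moves Su≡) (moves Sv≡)
                        (trans Su≡ (trans (flip-involutive i (flip j v)) (sym Sv≡)))

    predecessor : ∀ {w k′} c → Ranked w k′ → lookup (network (flip c w)) c ≡ lookup w c →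
                  ∃ λ k → Ranked (flip c w) k × k′ ≤ suc k
    predecessor c (encoded v) arrives with on-off-view v c
    ... | i , inj₁ refl =
      contradiction arrives (sole-rail-stays-on (enc v) v i (enc-on v i) (enc-off v i))
    ... | i , inj₂ refl = enc-predecessor v i (trans arrives (enc-off v i))
    predecessor c (moving {v} {j} Sv≡) arrives with on-off-view v c
    ... | i , inj₁ refl with i Fin.≟ j
    ...   | yes refl = contradiction arrives (no-backward-arc Sv≡)
    ...   | no i≢j =
      contradiction arrives (sole-rail-stays-on (edge j v) v i (lookup-edge-on v i j) (lookup-edge-off v i≢j))
    predecessor c (moving {v} {j} Sv≡) arrives | i , inj₂ refl with i Fin.≟ j
    ...   | yes refl =
      2 * rank v ,
      subst (λ w → Ranked w (2 * rank v)) (sym (flip-involutive (off v i) (enc v))) (encoded v) ,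
      ≤-refl
    ...   | no i≢j = contradiction arrives (no-sideways-arc Sv≡ i≢j)

    ranked-path : ∀ {w w′ len k′} → Path network w w′ len → Ranked w′ k′ →
                  ∃ λ k → Ranked w k × k′ ≤ k + len
    ranked-path here ranked = _ , ranked , ℕ.≤-reflexive (sym (ℕ.+-identityʳ _))
    ranked-path (step {x = w} {y = w₁} {k = len} a p) ranked with ranked-path p ranked
    ... | k₁ , ranked₁ , k′≤k₁+len with arc⇒flip {f = network} {w} {w₁} a
    ...   | c , refl , arrives with predecessor c ranked₁ arrives
    ...     | k , ranked₀ , k₁≤1+k = k , ranked₀ , (begin
      _           ≤⟨ k′≤k₁+len ⟩
      k₁ + len    ≤⟨ ℕ.+-monoˡ-≤ len k₁≤1+k ⟩
      suc k + len ≡⟨ ℕ.+-suc k len ⟨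
      k + suc len ∎)
      where open ℕ.≤-Reasoning

    ranked-enc : ∀ {w k} u → Ranked w k → w ≡ enc u → k ≡ 2 * rank u
    ranked-enc u (encoded v) v≡u = cong (λ x → 2 * rank x) (Vec.++-injectiveˡ v u v≡u)
    ranked-enc u (moving {v} {j} _) edge≡enc
      with () ← trans (sym (lookup-edge-rail v j (not (lookup u j))))
                      (trans (cong (λ x → lookup x (off u j)) edge≡enc) (enc-off u j))

    rank-lower-bound : ∀ a b {len} → Path network (enc a) (enc b) len → 2 * rank b ≤ 2 * rank a + len
    rank-lower-bound a b p with ranked-path p (encoded b)
    ... | k , ranked , bound = subst (λ k → 2 * rank b ≤ k + _) (ranked-enc a ranked refl) bound

    enc-step : ∀ {v j} → S v ≡ flip j v → Path network (enc v) (enc (S v)) 2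
    enc-step {v} {j} Sv≡ = step {y = edge j v} switch-on (step {y = enc (S v)} switch-off here)
      where
      Svⱼ≡ : lookup (S v) j ≡ not (lookup v j)
      Svⱼ≡ = trans (cong (λ x → lookup x j) Sv≡) (lookup-flip j v)
      switch-on : Arc network (enc v) (edge j v)
      switch-on = flip⇒arc {f = network} {enc v} (off v j) (begin
        lookup (network (enc v)) (off v j) ≡⟨ cong (λ x → lookup x (off v j)) (network-enc v) ⟩
        lookup (enc (S v)) (off v j)       ≡⟨ enc-rail-true (S v) j Svⱼ≡ ⟩
        true                               ≡⟨ cong not (enc-off v j) ⟨
        not (lookup (enc v) (off v j))     ∎)
        where open ≡-Reasoning
      switch-off : Arc network (edge j v) (enc (S v))
      switch-off = subst (Arc network (edge j v)) (trans (flip-on-edge v j) (cong enc (sym Sv≡)))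
        (flip⇒arc {f = network} {edge j v} (on v j) (begin
          lookup (network (edge j v)) (on v j)
            ≡⟨ network-edge v j (on v j) ⟩
          lookup (enc (S v)) (on v j) ∨ lookup (enc (S (flip j v))) (on v j)
            ≡⟨ cong₂ _∨_ (enc-rail-false (S v) j λ same → not-¬ refl (trans (sym same) Svⱼ≡))
                         (enc-rail-false (S (flip j v)) j λ same → not-¬ refl (trans (sym same) SSvⱼ≡)) ⟩
          false
            ≡⟨ cong not (lookup-edge-on v j j) ⟨
          not (lookup (edge j v) (on v j)) ∎))
        where
        open ≡-Reasoning
        SSvⱼ≡ : lookup (S (flip j v)) j ≡ not (lookup v j)
        SSvⱼ≡ = trans (cong (λ x → lookup (S x) j) (sym Sv≡)) (trans (no-return Sv≡) Svⱼ≡)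

    path-to-fixed-point : ∀ {B} → (∀ v → rank v < B) → ∀ v →
                          ∃ λ u → S u ≡ u × ∃ (Path network (enc v) (enc u))
    path-to-fixed-point {B} rank<B v = iterate B v (ℕ.m≤m+n B (rank v))
      where
      iterate : ∀ fuel v → B ≤ fuel + rank v →
                ∃ λ u → S u ≡ u × ∃ (Path network (enc v) (enc u))
      iterate fuel v B≤ with S-step v
      ... | inj₁ fixed = v , fixed , 0 , here
      iterate zero v B≤ | inj₂ _ = contradiction B≤ (ℕ.<⇒≱ (rank<B v))
      iterate (suc fuel) v B≤ | inj₂ (j , Sv≡)
        with iterate fuel (S v) (subst (λ r → B ≤ fuel + r) (sym (rank-S (moves Sv≡)))
                                       (subst (B ≤_) (sym (ℕ.+-suc fuel (rank v))) B≤))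
      ... | u , fixed , k , p = u , fixed , 2 + k , enc-step Sv≡ ++ᵖ p

-- The reflected Gray code

parity : ∀ {k} → Vec Bool k → Bool
parity [] = false
parity (b ∷ v) = b xor parity v

flipFirst : ∀ {k} → Vec Bool k → Vec Bool k
flipFirst [] = []
flipFirst (b ∷ v) = not b ∷ v

flipAfterFirstOne : ∀ {k} → Vec Bool k → Vec Bool k
flipAfterFirstOne [] = []
flipAfterFirstOne (true ∷ []) = true ∷ []
flipAfterFirstOne (true ∷ b ∷ v) = true ∷ not b ∷ v
flipAfterFirstOne (false ∷ v) = false ∷ flipAfterFirstOne v

grayNext : ∀ {k} → Vec Bool k → Vec Bool k
grayNext v = if parity v then flipAfterFirstOne v else flipFirst v

bit : Bool → ℕ
bit false = 0
bit true = 1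

-- Gray decoding, least significant bit first: the binary digit of weight 2^i is the parity of
-- the bits i, i + 1, ….
rank : ∀ {k} → Vec Bool k → ℕ
rank [] = 0
rank (b ∷ v) = bit (parity (b ∷ v)) + 2 * rank v

grayLast : ∀ k → Vec Bool (suc k)
grayLast zero = true ∷ []
grayLast (suc k) = false ∷ grayLast k

parity-flip : ∀ {k} (i : Fin k) v → parity (flip i v) ≡ not (parity v)
parity-flip zero (b ∷ v) = sym (Bool.not-distribˡ-xor b (parity v))
parity-flip (suc i) (b ∷ v) =
  trans (cong (b xor_) (parity-flip i v)) (sym (Bool.not-distribʳ-xor b (parity v)))

parity-moved : ∀ {k} {v w : Vec Bool k} → w ≡ v ⊎ ∃ (λ j → w ≡ flip j v) → w ≢ v →
               parity w ≡ not (parity v)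
parity-moved (inj₁ w≡v) w≢v = contradiction w≡v w≢v
parity-moved {v = v} (inj₂ (j , w≡)) _ = trans (cong parity w≡) (parity-flip j v)

flipAfterFirstOne-step : ∀ {k} (v : Vec Bool k) →
  flipAfterFirstOne v ≡ v ⊎ ∃ λ j → flipAfterFirstOne v ≡ flip j v
flipAfterFirstOne-step [] = inj₁ refl
flipAfterFirstOne-step (true ∷ []) = inj₁ refl
flipAfterFirstOne-step (true ∷ b ∷ v) = inj₂ (suc zero , refl)
flipAfterFirstOne-step (false ∷ v) with flipAfterFirstOne-step v
... | inj₁ fixed = inj₁ (cong (false ∷_) fixed)
... | inj₂ (j , moved) = inj₂ (suc j , cong (false ∷_) moved)

grayNext-step : ∀ {k} (v : Vec Bool k) → grayNext v ≡ v ⊎ ∃ λ j → grayNext v ≡ flip j v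
grayNext-step v with parity v
grayNext-step v | true = flipAfterFirstOne-step v
grayNext-step [] | false = inj₁ refl
grayNext-step (b ∷ v) | false = inj₂ (zero , refl)

rank-flipFirst : ∀ {k} {v : Vec Bool k} → parity v ≡ false → flipFirst v ≢ v →
                 rank (flipFirst v) ≡ suc (rank v)
rank-flipFirst {v = []} _ moving = contradiction refl moving
rank-flipFirst {v = b ∷ w} even _ = begin
  bit (not b xor parity w) + 2 * rank w
    ≡⟨ cong (λ x → bit x + 2 * rank w) (trans (sym (Bool.not-distribˡ-xor b _)) (cong not even)) ⟩
  suc (2 * rank w)
    ≡⟨ cong (λ x → suc (bit x + 2 * rank w)) even ⟨
  suc (rank (b ∷ w)) ∎
  where open ≡-Reasoning

rank-flipAfterFirstOne : ∀ {k} {v : Vec Bool k} → parity v ≡ true → flipAfterFirstOne v ≢ v →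
                         rank (flipAfterFirstOne v) ≡ suc (rank v)
rank-flipAfterFirstOne {v = true ∷ []} _ moving = contradiction refl moving
rank-flipAfterFirstOne {v = true ∷ b ∷ w} odd _ = begin
  bit (not (not b xor parity w)) + 2 * (bit (not b xor parity w) + 2 * rank w)
    ≡⟨ cong (λ x → bit (not x) + 2 * (bit x + 2 * rank w)) not-b-odd ⟩
  2 * suc (2 * rank w)
    ≡⟨ ℕ.*-suc 2 _ ⟩
  suc (suc (2 * (2 * rank w)))
    ≡⟨ cong (λ x → suc (bit (not x) + 2 * (bit x + 2 * rank w))) b-even ⟨
  suc (rank (true ∷ b ∷ w)) ∎
  where
  open ≡-Reasoning
  b-even : b xor parity w ≡ false
  b-even = not-injective odd
  not-b-odd : not b xor parity w ≡ true
  not-b-odd = trans (sym (Bool.not-distribˡ-xor b _)) (cong not b-even)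
rank-flipAfterFirstOne {v = false ∷ w} odd moving = begin
  bit (parity (flipAfterFirstOne w)) + 2 * rank (flipAfterFirstOne w)
    ≡⟨ cong₂ (λ p r → bit p + 2 * r)
             (trans (parity-moved (flipAfterFirstOne-step w) moving′) (cong not odd))
             (rank-flipAfterFirstOne odd moving′) ⟩
  2 * suc (rank w)
    ≡⟨ ℕ.*-suc 2 _ ⟩
  suc (suc (2 * rank w))
    ≡⟨ cong (λ p → suc (bit p + 2 * rank w)) odd ⟨
  suc (rank (false ∷ w)) ∎
  where
  open ≡-Reasoning
  moving′ : flipAfterFirstOne w ≢ w
  moving′ = moving ∘ cong (false ∷_)

rank-grayNext : ∀ {k} {v : Vec Bool k} → grayNext v ≢ v → rank (grayNext v) ≡ suc (rank v)
rank-grayNext {v = v} moving with parity v in p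
... | true = rank-flipAfterFirstOne p moving
... | false = rank-flipFirst p moving

flipFirst-injective : ∀ {k} {u v : Vec Bool k} → flipFirst u ≡ flipFirst v → u ≡ v
flipFirst-injective {u = []} {[]} _ = refl
flipFirst-injective {u = a ∷ u} {b ∷ v} eq =
  cong₂ _∷_ (not-injective (Vec.∷-injectiveˡ eq)) (Vec.∷-injectiveʳ eq)

flipAfterFirstOne-injective : ∀ {k} {u v : Vec Bool k} →
                              flipAfterFirstOne u ≡ flipAfterFirstOne v → u ≡ v
flipAfterFirstOne-injective {u = []} {[]} _ = refl
flipAfterFirstOne-injective {u = true ∷ []} {true ∷ []} _ = refl
flipAfterFirstOne-injective {u = true ∷ a ∷ u} {true ∷ b ∷ v} eq
  with Vec.∷-injective (Vec.∷-injectiveʳ eq)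
... | not-a≡not-b , u≡v = cong (true ∷_) (cong₂ _∷_ (not-injective not-a≡not-b) u≡v)
flipAfterFirstOne-injective {u = false ∷ u} {false ∷ v} eq =
  cong (false ∷_) (flipAfterFirstOne-injective (Vec.∷-injectiveʳ eq))
flipAfterFirstOne-injective {u = true ∷ []} {false ∷ _} ()
flipAfterFirstOne-injective {u = true ∷ _ ∷ _} {false ∷ _} ()
flipAfterFirstOne-injective {u = false ∷ _} {true ∷ []} ()
flipAfterFirstOne-injective {u = false ∷ _} {true ∷ _ ∷ _} ()

grayNext-injective : ∀ {k} {u v : Vec Bool k} → grayNext u ≢ u → grayNext v ≢ v →
                     grayNext u ≡ grayNext v → u ≡ v
grayNext-injective {u = u} {v} moving-u moving-v eq = same-parity-injective
  (not-injective (trans (sym (parity-moved (grayNext-step u) moving-u))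
                        (trans (cong parity eq) (parity-moved (grayNext-step v) moving-v)))) eq
  where
  same-parity-injective : parity u ≡ parity v → grayNext u ≡ grayNext v → u ≡ v
  same-parity-injective same eq with parity u | parity v
  ... | true | true = flipAfterFirstOne-injective eq
  ... | false | false = flipFirst-injective eq
  ... | true | false = contradiction same λ ()
  ... | false | true = contradiction same λ ()

grayNext-fixed : ∀ {k} (v : Vec Bool (suc k)) → grayNext v ≡ v → v ≡ grayLast k
grayNext-fixed v fixed with parity v in p
grayNext-fixed (b ∷ w) fixed | false = contradiction (sym (Vec.∷-injectiveˡ fixed)) (not-¬ refl)
grayNext-fixed v fixed | true = last-fixed v p fixed
  where
  last-fixed : ∀ {k} (v : Vec Bool (suc k)) → parity v ≡ true → flipAfterFirstOne v ≡ v →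
               v ≡ grayLast k
  last-fixed (true ∷ []) _ _ = refl
  last-fixed (true ∷ b ∷ w) _ fixed =
    contradiction (sym (Vec.∷-injectiveˡ (Vec.∷-injectiveʳ fixed))) (not-¬ refl)
  last-fixed (false ∷ b ∷ w) odd fixed =
    cong (false ∷_) (last-fixed (b ∷ w) odd (Vec.∷-injectiveʳ fixed))

grayNext-last : ∀ k → grayNext (grayLast k) ≡ grayLast k
grayNext-last k = trans
  (cong (λ p → if p then flipAfterFirstOne (grayLast k) else flipFirst (grayLast k)) (parity-last k))
  (flipAfterFirstOne-last k)
  where
  parity-last : ∀ k → parity (grayLast k) ≡ true
  parity-last zero = refl
  parity-last (suc k) = parity-last k
  flipAfterFirstOne-last : ∀ k → flipAfterFirstOne (grayLast k) ≡ grayLast k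
  flipAfterFirstOne-last zero = refl
  flipAfterFirstOne-last (suc k) = cong (false ∷_) (flipAfterFirstOne-last k)

rank-replicate-false : ∀ k → rank (replicate k false) ≡ 0
rank-replicate-false zero = refl
rank-replicate-false (suc k) =
  cong₂ (λ p r → bit p + 2 * r) (parity-replicate-false k) (rank-replicate-false k)
  where
  parity-replicate-false : ∀ k → parity (replicate k false) ≡ false
  parity-replicate-false zero = refl
  parity-replicate-false (suc k) = parity-replicate-false k

rank-grayLast : ∀ k → 2 ^ k ≤ rank (grayLast k)
rank-grayLast zero = ≤-refl
rank-grayLast (suc k) =
  ≤-trans (ℕ.*-monoʳ-≤ 2 (rank-grayLast k)) (ℕ.m≤n+m (2 * rank (grayLast k)) (bit (parity (grayLast k))))

rank<2^k : ∀ {k} (v : Vec Bool k) → rank v < 2 ^ k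
rank<2^k [] = ≤-refl
rank<2^k {suc k} (b ∷ v) = begin-strict
  bit (parity (b ∷ v)) + 2 * rank v <⟨ s≤s (ℕ.+-monoˡ-≤ (2 * rank v) (bit≤1 (parity (b ∷ v)))) ⟩
  2 + 2 * rank v                    ≡⟨ ℕ.*-suc 2 (rank v) ⟨
  2 * suc (rank v)                  ≤⟨ ℕ.*-monoʳ-≤ 2 (rank<2^k v) ⟩
  2 * 2 ^ k                         ∎
  where
  open ℕ.≤-Reasoning
  bit≤1 : ∀ b → bit b ≤ 1
  bit≤1 false = z≤n
  bit≤1 true = ≤-refl

FarFixedPoint : ℕ → Set
FarFixedPoint n = Σ (BN n) λ f → Monotone f ×
  Σ (Config n) λ x → Σ (Config n) λ y → (f y ≡ y) ×
    Σ ℕ λ d → Σ ℕ λ D → Dist f x y d × Diam f D × (D ≥ d) × (d ≥ 2 ^ (n / 2))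

far-fixed-point : ∀ k → FarFixedPoint (suc k + suc k)
far-fixed-point k =
  network , network-monotone , enc first , enc (grayLast k) , last-fixed ,
  proj₁ shortest , proj₁ diameter , proj₂ shortest ,
  proj₁ (proj₂ diameter) , proj₂ (proj₂ diameter) , far
  where
  open Network (grayNext {suc k})
  open Simulation rank grayNext-step grayNext-injective rank-grayNext
  open Distances network

  first : Vec Bool (suc k)
  first = replicate (suc k) false

  last-fixed : network (enc (grayLast k)) ≡ enc (grayLast k)
  last-fixed = trans (network-enc (grayLast k)) (cong enc (grayNext-last k))

  reaches-last : ∃ (Path network (enc first) (enc (grayLast k)))
  reaches-last with path-to-fixed-point rank<2^k first
  ... | u , fixed , path = subst (λ u → ∃ (Path network (enc first) (enc u))) (grayNext-fixed u fixed) path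

  shortest : ∃ (Dist network (enc first) (enc (grayLast k)))
  shortest = dist-exists (proj₂ reaches-last)

  diameter : ∃ λ D → Diam network D × proj₁ shortest ≤ D
  diameter = diam-exists (proj₂ shortest)

  far : 2 ^ ((suc k + suc k) / 2) ≤ proj₁ shortest
  far = begin
    2 ^ ((suc k + suc k) / 2)       ≡⟨ cong (2 ^_) (half (suc k)) ⟩
    2 * 2 ^ k                       ≤⟨ ℕ.*-monoʳ-≤ 2 (rank-grayLast k) ⟩
    2 * rank (grayLast k)           ≤⟨ rank-lower-bound first (grayLast k) (proj₁ (proj₂ shortest)) ⟩
    2 * rank first + proj₁ shortest ≡⟨ cong (λ r → 2 * r + proj₁ shortest) (rank-replicate-false (suc k)) ⟩
    proj₁ shortest                  ∎
    where
    open ℕ.≤-Reasoning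
    half : ∀ m → (m + m) / 2 ≡ m
    half m = trans (cong (_/ 2) (trans (cong (m +_) (sym (ℕ.+-identityʳ m))) (ℕ.*-comm 2 m)))
                   (m*n/n≡m m 2)

theorem4 : (n : ℕ) → 0 < n → 2 ∣ n →
    Σ (BN n) λ f → Monotone f ×
      Σ (Config n) λ x → Σ (Config n) λ y → (f y ≡ y) ×
        Σ ℕ λ d → Σ ℕ λ D → Dist f x y d × Diam f D ×
          (D ≥ d) × (d ≥ 2 ^ (n / 2))
theorem4 n 0<n (divides zero n≡0) = contradiction n≡0 (ℕ.>⇒≢ 0<n)
theorem4 n _ (divides (suc k) n≡) = subst FarFixedPoint (sym (trans n≡ doubled)) (far-fixed-point k)
  where
  doubled : suc k * 2 ≡ suc k + suc k
  doubled = trans (ℕ.*-comm (suc k) 2) (cong (suc k +_) (ℕ.+-identityʳ (suc k)))
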